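{- Let $A$ be an instance and $K\in\{\mathbb{B},\mathbb{N}\}$. Then the following are equivalent: (1) $[A]$ has a left query algorithm over $K$; (2) $\mathrm{CSP}(A)$ has a left query algorithm over $K$.
   Context: An instance $A$ over a schema assigns to each relation symbol a finite relation of its arity; $\mathrm{adom}(A)$ is the set of entries of its tuples. A homomorphism $A\to B$ is a map $\mathrm{adom}(A)\to\mathrm{adom}(B)$ mapping tuples of each $R^A$ into $R^B$. $[A]$ is the class of instances $B$ with $A\to B$ and $B\to A$; $\mathrm{CSP}(A)=\{B: B\to A\}$. $\hom_{\mathbb{N}}(F,D)$ is the number of homomorphisms $F\to D$, $\hom_{\mathbb{B}}(F,D)$ is $1$ if one exists and $0$ otherwise. A class $\mathcal{C}$ has a left query algorithm over $K$ if there are $k>0$, instances $F_1,\dots,F_k$ and a set $X$ of $k$-tuples over $K$ such that for every instance $D$: $D\in\mathcal{C}$ iff $(\hom_K(F_1,D),\dots,\hom_K(F_k,D))\in X$. -}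

module Defs where

open import Data.Nat using (ℕ; zero; suc; _≟_; _>_; _≡ᵇ_)
open import Data.Bool using (if_then_else_)
open import Data.Fin using (Fin)
open import Data.Fin.Properties using () renaming (all? to allFin?)
open import Data.Vec using (Vec)
import Data.Vec as Vec
open import Data.Vec.Properties using (≡-dec)
open import Data.List using (List; []; _∷_; length; filter; concatMap; concat; map; deduplicate)
open import Data.List.Membership.Propositional using (_∈_)
import Data.List.Membership.DecPropositional as DecMem
open import Data.List.Relation.Unary.All using (All; all?)
open import Data.Product using (Σ; ∃; _×_)
open import Relation.Nullary using (Dec)
open import Function.Bundles using (_⇔_)
open import Level using (Level)

record Schema : Set where
  field
    nsym  : ℕ
    arity : Fin nsym → ℕ
open Schema public

Instance : Schema → Set
Instance σ = (R : Fin (nsym σ)) → List (Vec ℕ (arity σ R))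

adom : {σ : Schema} → Instance σ → List ℕ
adom {σ} A = deduplicate _≟_
  (concatMap (λ R → concatMap Vec.toList (A R)) (Data.List.allFin (nsym σ)))
  where import Data.List

IsHomMap : {σ : Schema} → Instance σ → Instance σ → (ℕ → ℕ) → Set
IsHomMap {σ} A B h = (R : Fin (nsym σ)) → All (λ t → Vec.map h t ∈ B R) (A R)

isHomMap? : {σ : Schema} (A B : Instance σ) (h : ℕ → ℕ) → Dec (IsHomMap A B h)
isHomMap? {σ} A B h = allFin? (λ R → all? (λ t → DecMem._∈?_ (≡-dec {n = arity σ R} _≟_) (Vec.map h t) (B R)) (A R))

Hom : {σ : Schema} → Instance σ → Instance σ → Set
Hom A B = ∃ λ h → IsHomMap A B h

-- Enumeration of all maps adom(A) → adom(B):
-- a map is given by the list of images of the elements of adom(A) (in order).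
images : ℕ → List ℕ → List (List ℕ)
images zero    ys = [] ∷ []
images (suc n) ys = concatMap (λ y → map (y ∷_) (images n ys)) ys

app : List ℕ → List ℕ → ℕ → ℕ
app (x ∷ xs) (y ∷ ys) a = if a ≡ᵇ x then y else app xs ys a
app _        _        a = 0

homCount : {σ : Schema} → Instance σ → Instance σ → ℕ
homCount F D =
  length (filter (λ img → isHomMap? F D (app (adom F) img))
                 (images (length (adom F)) (adom D)))

data K : Set where
  𝔹 ℕK : K

hom : {σ : Schema} → K → Instance σ → Instance σ → ℕ
hom ℕK F D = homCount F D
hom 𝔹  F D = if homCount F D ≡ᵇ 0 then 0 else 1

Class : Schema → Set₁
Class σ = Instance σ → Set

HomEq : {σ : Schema} → Instance σ → Class σ
HomEq A B = Hom A B × Hom B A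

CSP : {σ : Schema} → Instance σ → Class σ
CSP A B = Hom B A

LeftQueryAlgorithm : {σ : Schema} → K → Class σ → Set₁
LeftQueryAlgorithm {σ} κ C =
  Σ ℕ λ k → k > 0 × Σ (Vec (Instance σ) k) λ Fs → Σ (Vec ℕ k → Set) λ X →
    (D : Instance σ) → (C D ⇔ X (Vec.map (λ F → hom κ F D) Fs))

-- A homomorphism from F into the disjoint union A↑∪ D of D with a copy A↑ of A (shifted
-- away from the constants of D) splits F along a two-colouring s of adom F: one part goes
-- to A↑, the other (right F s) to D. Hence
--   hom(F, A↑∪ D) = ∑ₛ aₛ · hom(right F s, D)      (aₛ independent of D),
-- and the same holds over 𝔹 after the semiring homomorphism ℕ → 𝔹. Since D ∈ CSP(A) iff
-- A↑∪ D ∈ [A] and the nullary facts of D hold in A, a left query algorithm F₁, …, F_k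
-- for [A] yields one for CSP(A) whose queries are the right Fᵢ s together with one
-- single-fact query per relation (for the nullary facts, which A↑∪ D drops).
-- Conversely [A] = CSP(A) ∩ {D : hom(A, D) ≠ 0}.

module Submission where

open import Defs
open import Algebra.Properties.CommutativeSemigroup using (interchange)
open import Data.Bool using (Bool; true; false; T; if_then_else_)
import Data.Bool.Properties as Bool
open import Data.Empty using (⊥; ⊥-elim)
open import Data.Fin as Fin using (Fin)
open import Data.Fin.Properties using (all?)
open import Data.List using (List; []; _∷_; _++_; map; length; filter; concatMap; allFin)
open import Data.List.Extrema.Nat using (max; xs≤max)
open import Data.List.Properties using (map-++; map-cong-local; map-∘)
open import Data.List.Membership.Propositional using (_∈_; find)
open import Data.List.Membership.Propositional.Properties
  using (∈-concatMap⁺; ∈-concatMap⁻; deduplicate-∈⇔; ∈-allFin; ∈-map⁺; ∈-map⁻;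
         ∈-filter⁺; ∈-filter⁻; ∈-++⁺ˡ; ∈-++⁺ʳ; ∈-++⁻)
open import Data.List.Membership.Propositional.Properties.WithK using (unique∧set⇒bag)
open import Data.List.Relation.Binary.BagAndSetEquality using (∼bag⇒↭)
open import Data.List.Relation.Binary.Permutation.Propositional as ↭ using (_↭_; ↭⇒↭ₛ)
import Data.List.Relation.Binary.Permutation.Propositional.Properties as ↭
import Data.List.Relation.Binary.Permutation.Setoid.Properties as ↭ₛ
open import Data.List.Relation.Binary.Subset.Propositional using (_⊆_)
open import Data.List.Relation.Unary.All as All using (All; _∷_)
open import Data.List.Relation.Unary.Any as Any using (here; there)
open import Data.List.Relation.Unary.Unique.Propositional using (Unique; []; _∷_)
import Data.List.Relation.Unary.Unique.Propositional.Properties as Unique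
import Data.List.Relation.Unary.Unique.DecPropositional.Properties as DecUnique
open import Data.Nat using (ℕ; zero; suc; _+_; _*_; _∸_; _≟_; _≡ᵇ_; _≤_; _<_; _≤?_; z≤n; s≤s)
open import Data.Nat.ListAction using (sum)
open import Data.Nat.ListAction.Properties using (sum-++; sum-↭)
open import Data.Nat.Properties
  using (+-commutativeSemigroup; +-identityʳ; *-comm; *-distribʳ-+; m+n≡0⇒m≡0; m+n≡0⇒n≡0;
         ≡ᵇ⇒≡; ≡⇒≡ᵇ; <⇒≱; m≤n+m; m+n∸n≡m)
open import Data.Product using (∃; _×_; _,_; proj₁; proj₂)
open import Data.Sum as Sum using (_⊎_; inj₁; inj₂)
open import Data.Unit using (tt)
open import Data.Vec using (Vec; []; _∷_; toList)
import Data.Vec as Vec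
import Data.Vec.Properties as Vec
open import Function using (_∘_; case_of_)
open import Function.Bundles using (_⇔_; mk⇔; Equivalence)
open import Relation.Binary.PropositionalEquality
open import Relation.Nullary using (Dec; yes; no; ¬_; _×-dec_; _⊎-dec_; decidable-stable)
open import Relation.Unary using (Decidable)

private
  variable
    A B : Set

∑ : List A → (A → ℕ) → ℕ
∑ xs f = sum (map f xs)

∑-cong : (xs : List A) {f g : A → ℕ} → (∀ {x} → x ∈ xs → f x ≡ g x) → ∑ xs f ≡ ∑ xs g
∑-cong xs f≡g = cong sum (map-cong-local (All.tabulate f≡g))

∑-zero : (xs : List A) → ∑ xs (λ _ → 0) ≡ 0
∑-zero []       = refl
∑-zero (_ ∷ xs) = ∑-zero xs

∑-++ : (xs ys : List A) (f : A → ℕ) → ∑ (xs ++ ys) f ≡ ∑ xs f + ∑ ys f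
∑-++ xs ys f = trans (cong sum (map-++ f xs ys)) (sum-++ (map f xs) (map f ys))

∑-map : (g : B → A) (xs : List B) (f : A → ℕ) → ∑ (map g xs) f ≡ ∑ xs (f ∘ g)
∑-map g xs f = cong sum (sym (map-∘ xs))

∑-↭ : {xs ys : List A} (f : A → ℕ) → xs ↭ ys → ∑ xs f ≡ ∑ ys f
∑-↭ f p = sum-↭ (↭.map⁺ f p)

∑-+ : (xs : List A) (f g : A → ℕ) → ∑ xs (λ x → f x + g x) ≡ ∑ xs f + ∑ xs g
∑-+ []       f g = refl
∑-+ (x ∷ xs) f g =
  trans (cong (f x + g x +_) (∑-+ xs f g)) (interchange +-commutativeSemigroup (f x) (g x) (∑ xs f) (∑ xs g))

∑-*ʳ : (xs : List A) (f : A → ℕ) (c : ℕ) → ∑ xs (λ x → f x * c) ≡ ∑ xs f * c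
∑-*ʳ []       f c = refl
∑-*ʳ (x ∷ xs) f c = trans (cong (f x * c +_) (∑-*ʳ xs f c)) (sym (*-distribʳ-+ c (f x) (∑ xs f)))

∑-*ˡ : (xs : List A) (c : ℕ) (f : A → ℕ) → ∑ xs (λ x → c * f x) ≡ c * ∑ xs f
∑-*ˡ xs c f = trans (∑-cong xs (λ {x} _ → *-comm c (f x))) (trans (∑-*ʳ xs f c) (*-comm _ c))

∑-swap : (xs : List A) (ys : List B) (f : A → B → ℕ) →
         ∑ xs (λ x → ∑ ys (f x)) ≡ ∑ ys (λ y → ∑ xs (λ x → f x y))
∑-swap []       ys f = sym (∑-zero ys)
∑-swap (x ∷ xs) ys f =
  trans (cong (∑ ys (f x) +_) (∑-swap xs ys f)) (sym (∑-+ ys (f x) (λ y → ∑ xs (λ x′ → f x′ y))))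

∑≢0⇒ : (xs : List A) (f : A → ℕ) → ∑ xs f ≢ 0 → ∃ λ x → x ∈ xs × f x ≢ 0
∑≢0⇒ []       f ∑≢0 = ⊥-elim (∑≢0 refl)
∑≢0⇒ (x ∷ xs) f ∑≢0 with f x ≟ 0
... | no fx≢0 = x , here refl , fx≢0
... | yes fx≡0 with ∑≢0⇒ xs f (λ ∑≡0 → ∑≢0 (cong₂ _+_ fx≡0 ∑≡0))
...   | y , y∈xs , fy≢0 = y , there y∈xs , fy≢0

∑≢0⇐ : (xs : List A) (f : A → ℕ) {x : A} → x ∈ xs → f x ≢ 0 → ∑ xs f ≢ 0
∑≢0⇐ (y ∷ xs) f (here refl) fx≢0 ∑≡0 = fx≢0 (m+n≡0⇒m≡0 (f y) ∑≡0)
∑≢0⇐ (y ∷ xs) f (there x∈xs) fx≢0 ∑≡0 = ∑≢0⇐ xs f x∈xs fx≢0 (m+n≡0⇒n≡0 (f y) ∑≡0)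

*-congˡ-when-≢0 : ∀ a {x y} → (a ≢ 0 → x ≡ y) → a * x ≡ a * y
*-congˡ-when-≢0 zero    _   = refl
*-congˡ-when-≢0 (suc a) x≡y = cong (suc a *_) (x≡y (λ ()))

∑-concatMap : (f : A → List B) (xs : List A) (h : B → ℕ) →
              ∑ (concatMap f xs) h ≡ ∑ xs (λ x → ∑ (f x) h)
∑-concatMap f []       h = refl
∑-concatMap f (x ∷ xs) h =
  trans (∑-++ (f x) (concatMap f xs) h) (cong (∑ (f x) h +_) (∑-concatMap f xs h))

indicator : {P : Set} → Dec P → ℕ
indicator (yes _) = 1
indicator (no _)  = 0

length-filter : {P : A → Set} (P? : Decidable P) (xs : List A) →
                length (filter P? xs) ≡ ∑ xs (indicator ∘ P?)
length-filter P? []       = refl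
length-filter P? (x ∷ xs) with P? x
... | yes _ = cong suc (length-filter P? xs)
... | no _  = length-filter P? xs

indicator-× : {P Q : Set} (P? : Dec P) (Q? : Dec Q) → indicator (P? ×-dec Q?) ≡ indicator P? * indicator Q?
indicator-× (yes _) (yes _) = refl
indicator-× (yes _) (no _)  = refl
indicator-× (no _)  _       = refl

indicator≢0⇔ : {P : Set} (P? : Dec P) → indicator P? ≢ 0 ⇔ P
indicator≢0⇔ (yes p) = mk⇔ (λ _ → p) (λ _ ())
indicator≢0⇔ (no ¬p) = mk⇔ (λ 0≢0 → ⊥-elim (0≢0 refl)) (λ p → ⊥-elim (¬p p))

indicator-⇔ : {P Q : Set} (P? : Dec P) (Q? : Dec Q) → P ⇔ Q → indicator P? ≡ indicator Q?
indicator-⇔ (yes _) (yes _) _   = refl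
indicator-⇔ (yes p) (no ¬q) P⇔Q = ⊥-elim (¬q (Equivalence.to P⇔Q p))
indicator-⇔ (no ¬p) (yes q) P⇔Q = ⊥-elim (¬p (Equivalence.from P⇔Q q))
indicator-⇔ (no _)  (no _)  _   = refl

Unique-⊆-antisym : {xs ys : List A} → Unique xs → Unique ys → xs ⊆ ys → ys ⊆ xs → xs ↭ ys
Unique-⊆-antisym uxs uys xs⊆ys ys⊆xs = ∼bag⇒↭ (unique∧set⇒bag uxs uys (mk⇔ xs⊆ys ys⊆xs))

∈-toList-map⁺ : (g : A → B) {n : ℕ} (t : Vec A n) {a : A} → a ∈ toList t → g a ∈ toList (Vec.map g t)
∈-toList-map⁺ g t a∈ = subst (_ ∈_) (sym (Vec.toList-map g t)) (∈-map⁺ g a∈)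

∈-toList-map⁻ : (g : A → B) {n : ℕ} (t : Vec A n) {b : B} →
                b ∈ toList (Vec.map g t) → ∃ λ a → a ∈ toList t × b ≡ g a
∈-toList-map⁻ g t b∈ = ∈-map⁻ g (subst (_ ∈_) (Vec.toList-map g t) b∈)

Vec-map-cong-local : (g g′ : A → B) {n : ℕ} (t : Vec A n) →
                     (∀ {a} → a ∈ toList t → g a ≡ g′ a) → Vec.map g t ≡ Vec.map g′ t
Vec-map-cong-local g g′ []      g≡g′ = refl
Vec-map-cong-local g g′ (a ∷ t) g≡g′ =
  cong₂ _∷_ (g≡g′ (here refl)) (Vec-map-cong-local g g′ t (g≡g′ ∘ there))

Vec-map-≡⇒∈-≡ : (g g′ : A → B) {n : ℕ} (t : Vec A n) →
                Vec.map g t ≡ Vec.map g′ t → ∀ {a} → a ∈ toList t → g a ≡ g′ a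
Vec-map-≡⇒∈-≡ g g′ (a ∷ t) gt≡g′t (here refl)  = Vec.∷-injectiveˡ gt≡g′t
Vec-map-≡⇒∈-≡ g g′ (a ∷ t) gt≡g′t (there a∈t) =
  Vec-map-≡⇒∈-≡ g g′ t (Vec.∷-injectiveʳ gt≡g′t) a∈t

_[_↦_] : (ℕ → B) → ℕ → B → ℕ → B
(g [ x ↦ y ]) a = if a ≡ᵇ x then y else g a

[↦]-same : ∀ (g : ℕ → B) x y → (g [ x ↦ y ]) x ≡ y
[↦]-same g x y with x ≡ᵇ x in eq
... | true  = refl
... | false = ⊥-elim (subst T eq (≡⇒≡ᵇ x x refl))

[↦]-other : ∀ (g : ℕ → B) x y {a} → a ≢ x → (g [ x ↦ y ]) a ≡ g a
[↦]-other g x y {a} a≢x with a ≡ᵇ x in eq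
... | true  = ⊥-elim (a≢x (≡ᵇ⇒≡ a x (subst T (sym eq) tt)))
... | false = refl

[↦]-self : ∀ (g : ℕ → B) x a → (g [ x ↦ g x ]) a ≡ g a
[↦]-self g x a with a ≟ x
... | yes refl = [↦]-same g x (g x)
... | no a≢x   = [↦]-other g x (g x) a≢x

[↦]-comm : ∀ (g : ℕ → B) {x z} a b → x ≢ z →
           ∀ c → (g [ z ↦ b ] [ x ↦ a ]) c ≡ (g [ x ↦ a ] [ z ↦ b ]) c
[↦]-comm g {x} {z} a b x≢z c with c ≟ x | c ≟ z
... | yes refl | yes refl = ⊥-elim (x≢z refl)
... | yes refl | no c≢z   = begin
  (g [ z ↦ b ] [ c ↦ a ]) c ≡⟨ [↦]-same (g [ z ↦ b ]) c a ⟩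
  a                         ≡⟨ [↦]-same g c a ⟨
  (g [ c ↦ a ]) c           ≡⟨ [↦]-other (g [ c ↦ a ]) z b c≢z ⟨
  (g [ c ↦ a ] [ z ↦ b ]) c ∎
  where open ≡-Reasoning
... | no c≢x   | yes refl = begin
  (g [ c ↦ b ] [ x ↦ a ]) c ≡⟨ [↦]-other (g [ c ↦ b ]) x a c≢x ⟩
  (g [ c ↦ b ]) c           ≡⟨ [↦]-same g c b ⟩
  b                         ≡⟨ [↦]-same (g [ x ↦ a ]) c b ⟨
  (g [ x ↦ a ] [ c ↦ b ]) c ∎
  where open ≡-Reasoning
... | no c≢x   | no c≢z   = begin
  (g [ z ↦ b ] [ x ↦ a ]) c ≡⟨ [↦]-other (g [ z ↦ b ]) x a c≢x ⟩
  (g [ z ↦ b ]) c           ≡⟨ [↦]-other g z b c≢z ⟩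
  g c                       ≡⟨ [↦]-other g x a c≢x ⟨
  (g [ x ↦ a ]) c           ≡⟨ [↦]-other (g [ x ↦ a ]) z b c≢z ⟨
  (g [ x ↦ a ] [ z ↦ b ]) c ∎
  where open ≡-Reasoning

[↦]-cong : ∀ (g g′ : ℕ → B) x y {a} → g a ≡ g′ a → (g [ x ↦ y ]) a ≡ (g′ [ x ↦ y ]) a
[↦]-cong g g′ x y {a} = cong (if a ≡ᵇ x then y else_)

-- Sums over all maps between finite sets

Weight : Set
Weight = (ℕ → ℕ) → ℕ

-- The sum of w over all maps xs → ys, extended by 0 outside xs.
∑maps : List ℕ → List ℕ → Weight → ℕ
∑maps []       ys w = w (λ _ → 0)
∑maps (x ∷ xs) ys w = ∑ ys λ y → ∑maps xs ys (λ g → w (g [ x ↦ y ]))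

∑-images : (xs ys : List ℕ) (w : Weight) → ∑ (images (length xs) ys) (w ∘ app xs) ≡ ∑maps xs ys w
∑-images []       ys w = +-identityʳ _
∑-images (x ∷ xs) ys w = begin
  ∑ (concatMap (λ y → map (y ∷_) (images (length xs) ys)) ys) (w ∘ app (x ∷ xs))
    ≡⟨ ∑-concatMap _ ys _ ⟩
  ∑ ys (λ y → ∑ (map (y ∷_) (images (length xs) ys)) (w ∘ app (x ∷ xs)))
    ≡⟨ ∑-cong ys (λ {y} _ → ∑-map (y ∷_) (images (length xs) ys) (w ∘ app (x ∷ xs))) ⟩
  ∑ ys (λ y → ∑ (images (length xs) ys) (λ img → w (app xs img [ x ↦ y ])))
    ≡⟨ ∑-cong ys (λ {y} _ → ∑-images xs ys (λ g → w (g [ x ↦ y ]))) ⟩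
  ∑maps (x ∷ xs) ys w ∎
  where open ≡-Reasoning

∑maps-cong : ∀ xs ys {w w′ : Weight} → (∀ g → w g ≡ w′ g) → ∑maps xs ys w ≡ ∑maps xs ys w′
∑maps-cong []       ys w≡w′ = w≡w′ _
∑maps-cong (x ∷ xs) ys w≡w′ = ∑-cong ys (λ {y} _ → ∑maps-cong xs ys (λ g → w≡w′ (g [ x ↦ y ])))

∑maps-zero : ∀ xs ys → ∑maps xs ys (λ _ → 0) ≡ 0
∑maps-zero []       ys = refl
∑maps-zero (x ∷ xs) ys = trans (∑-cong ys (λ _ → ∑maps-zero xs ys)) (∑-zero ys)

DependsOn : List ℕ → Weight → Set
DependsOn L w = ∀ g g′ → (∀ {a} → a ∈ L → g a ≡ g′ a) → w g ≡ w g′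

Extensional : Weight → Set
Extensional w = ∀ g g′ → (∀ a → g a ≡ g′ a) → w g ≡ w g′

MapsInto : List ℕ → List ℕ → (ℕ → ℕ) → Set
MapsInto xs ys g = ∀ {a} → a ∈ xs → g a ∈ ys

DependsOn-[↦] : ∀ x y L w → DependsOn (x ∷ L) w → DependsOn L (λ g → w (g [ x ↦ y ]))
DependsOn-[↦] x y L w dep g g′ g≡g′ = dep _ _ λ where
  (here refl) → trans ([↦]-same g x y) (sym ([↦]-same g′ x y))
  (there a∈L) → [↦]-cong g g′ x y (g≡g′ a∈L)

Extensional-[↦] : ∀ x y w → Extensional w → Extensional (λ g → w (g [ x ↦ y ]))
Extensional-[↦] x y w ext g g′ g≗g′ = ext _ _ (λ a → [↦]-cong g g′ x y (g≗g′ a))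

DependsOn⇒Extensional : ∀ {L w} → DependsOn L w → Extensional w
DependsOn⇒Extensional dep g g′ g≗g′ = dep g g′ (λ {a} _ → g≗g′ a)

∑maps≢0⇐ : ∀ xs ys w → DependsOn xs w → ∀ g → MapsInto xs ys g → w g ≢ 0 → ∑maps xs ys w ≢ 0
∑maps≢0⇐ []       ys w dep g g∈ wg≢0 = wg≢0 ∘ trans (dep g _ (λ ()))
∑maps≢0⇐ (x ∷ xs) ys w dep g g∈ wg≢0 =
  ∑≢0⇐ ys _ (g∈ (here refl))
    (∑maps≢0⇐ xs ys _ (DependsOn-[↦] x (g x) xs w dep) g (g∈ ∘ there)
      (wg≢0 ∘ trans (dep g _ (λ {a} _ → sym ([↦]-self g x a)))))

∑maps≢0⇒ : ∀ xs ys w → ∑maps xs ys w ≢ 0 → ∃ λ g → MapsInto xs ys g × w g ≢ 0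
∑maps≢0⇒ []       ys w ∑≢0 = (λ _ → 0) , (λ ()) , ∑≢0
∑maps≢0⇒ (x ∷ xs) ys w ∑≢0 with ∑≢0⇒ ys _ ∑≢0
... | y , y∈ys , ∑′≢0 with ∑maps≢0⇒ xs ys _ ∑′≢0
...   | g , g∈ , wg≢0 = g [ x ↦ y ] , g′∈ , wg≢0
  where
  g′∈ : MapsInto (x ∷ xs) ys (g [ x ↦ y ])
  g′∈ {a} a∈ with a ≟ x | a∈
  ... | yes refl | _           = subst (_∈ ys) (sym ([↦]-same g x y)) y∈ys
  ... | no a≢x   | here refl   = ⊥-elim (a≢x refl)
  ... | no a≢x   | there a∈xs = subst (_∈ ys) (sym ([↦]-other g x y a≢x)) (g∈ a∈xs)

∑maps-↭ʳ : ∀ xs {ys ys′} w → ys ↭ ys′ → ∑maps xs ys w ≡ ∑maps xs ys′ w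
∑maps-↭ʳ []       w p = refl
∑maps-↭ʳ (x ∷ xs) {ys} w p =
  trans (∑-cong ys (λ {y} _ → ∑maps-↭ʳ xs (λ g → w (g [ x ↦ y ])) p)) (∑-↭ _ p)

∑maps-↭ˡ : ∀ {xs xs′} ys w → Extensional w → Unique xs → xs ↭ xs′ →
           ∑maps xs ys w ≡ ∑maps xs′ ys w
∑maps-↭ˡ ys w ext u ↭.refl = refl
∑maps-↭ˡ ys w ext (_ ∷ u) (↭.prep x p) =
  ∑-cong ys (λ {y} _ → ∑maps-↭ˡ ys _ (Extensional-[↦] x y w ext) u p)
∑maps-↭ˡ {x ∷ z ∷ xs} {.z ∷ .x ∷ xs′} ys w ext ((x≢z ∷ _) ∷ (_ ∷ u)) (↭.swap .x .z p) = begin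
  ∑ ys (λ a → ∑ ys (λ b → ∑maps xs ys (λ g → w (g [ z ↦ b ] [ x ↦ a ]))))
    ≡⟨ ∑-cong ys (λ {a} _ → ∑-cong ys (λ {b} _ →
         ∑maps-↭ˡ ys _ (Extensional-[↦] z b _ (Extensional-[↦] x a w ext)) u p)) ⟩
  ∑ ys (λ a → ∑ ys (λ b → ∑maps xs′ ys (λ g → w (g [ z ↦ b ] [ x ↦ a ]))))
    ≡⟨ ∑-swap ys ys _ ⟩
  ∑ ys (λ b → ∑ ys (λ a → ∑maps xs′ ys (λ g → w (g [ z ↦ b ] [ x ↦ a ]))))
    ≡⟨ ∑-cong ys (λ {b} _ → ∑-cong ys (λ {a} _ →
         ∑maps-cong xs′ ys (λ g → ext _ _ ([↦]-comm g a b x≢z)))) ⟩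
  ∑ ys (λ b → ∑ ys (λ a → ∑maps xs′ ys (λ g → w (g [ x ↦ a ] [ z ↦ b ])))) ∎
  where open ≡-Reasoning
∑maps-↭ˡ ys w ext u (↭.trans p q) =
  trans (∑maps-↭ˡ ys w ext u p) (∑maps-↭ˡ ys w ext (↭ₛ.Unique-resp-↭ (setoid ℕ) (↭⇒↭ₛ p) u) q)

-- Splitting the domain by a bit vector

bitVectors : (n : ℕ) → List (Vec Bool n)
bitVectors zero    = [] ∷ []
bitVectors (suc n) = map (false ∷_) (bitVectors n) ++ map (true ∷_) (bitVectors n)

select : Bool → (xs : List ℕ) → Vec Bool (length xs) → List ℕ
select b []       []      = []
select b (x ∷ xs) (c ∷ s) with c Bool.≟ b
... | yes _ = x ∷ select b xs s
... | no _  = select b xs s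

-- The bit of the first occurrence of a in xs (false if a ∉ xs).
bitOf : (xs : List ℕ) → Vec Bool (length xs) → ℕ → Bool
bitOf []       []      a = false
bitOf (x ∷ xs) (c ∷ s) = bitOf xs s [ x ↦ c ]

select-here : ∀ b x xs s → x ∈ select b (x ∷ xs) (b ∷ s)
select-here b x xs s with b Bool.≟ b
... | yes _   = here refl
... | no b≢b = ⊥-elim (b≢b refl)

select-there : ∀ b x xs c s {a} → a ∈ select b xs s → a ∈ select b (x ∷ xs) (c ∷ s)
select-there b x xs c s a∈ with c Bool.≟ b
... | yes _ = there a∈
... | no _  = a∈

select⁺ : ∀ b xs s {a} → a ∈ xs → bitOf xs s a ≡ b → a ∈ select b xs s
select⁺ b (x ∷ xs) (c ∷ s) {a} a∈ bit≡b with a ≟ x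
... | yes refl rewrite sym (trans (sym ([↦]-same (bitOf xs s) a c)) bit≡b) = select-here c a xs s
... | no a≢x = select-there b x xs c s
                 (select⁺ b xs s (Any.tail a≢x a∈) (trans (sym ([↦]-other (bitOf xs s) x c a≢x)) bit≡b))

select-∷⁻ : ∀ b x xs c s {a} → a ∈ select b (x ∷ xs) (c ∷ s) → (a ≡ x × c ≡ b) ⊎ a ∈ select b xs s
select-∷⁻ b x xs c s a∈ with c Bool.≟ b | a∈
... | yes c≡b | here a≡x    = inj₁ (a≡x , c≡b)
... | yes _   | there a∈sel = inj₂ a∈sel
... | no _    | a∈sel       = inj₂ a∈sel

select-⊆ : ∀ b xs s {a} → a ∈ select b xs s → a ∈ xs
select-⊆ b []       []      ()
select-⊆ b (x ∷ xs) (c ∷ s) a∈ with select-∷⁻ b x xs c s a∈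
... | inj₁ (refl , _) = here refl
... | inj₂ a∈sel      = there (select-⊆ b xs s a∈sel)

select-∉ : ∀ b {x} xs s {a} → All (x ≢_) xs → a ∈ select b xs s → a ≢ x
select-∉ b xs s x∉xs a∈sel refl = All.lookup x∉xs (select-⊆ b xs s a∈sel) refl

select⁻ : ∀ b xs s {a} → Unique xs → a ∈ select b xs s → bitOf xs s a ≡ b
select⁻ b []       []      []           ()
select⁻ b (x ∷ xs) (c ∷ s) (x∉xs ∷ u) a∈ with select-∷⁻ b x xs c s a∈
... | inj₁ (refl , c≡b) = trans ([↦]-same (bitOf xs s) x c) c≡b
... | inj₂ a∈sel        =
  trans ([↦]-other (bitOf xs s) x c (select-∉ b xs s x∉xs a∈sel)) (select⁻ b xs s u a∈sel)

select-unique : ∀ b xs s → Unique xs → Unique (select b xs s)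
select-unique b []       []      []           = []
select-unique b (x ∷ xs) (c ∷ s) (x∉xs ∷ u) with c Bool.≟ b
... | yes _ = All.tabulate (All.lookup x∉xs ∘ select-⊆ b xs s) ∷ select-unique b xs s u
... | no _  = select-unique b xs s u

-- Y b is the codomain of the points whose bit is b.
∑split : (Bool → List ℕ) → (xs : List ℕ) → Vec Bool (length xs) → Weight → ℕ
∑split Y []       []      w = w (λ _ → 0)
∑split Y (x ∷ xs) (c ∷ s) w = ∑ (Y c) λ y → ∑split Y xs s (λ g → w (g [ x ↦ y ]))

Respects : (Bool → List ℕ) → (xs : List ℕ) → Vec Bool (length xs) → (ℕ → ℕ) → Set
Respects Y xs s g = ∀ b → MapsInto (select b xs s) (Y b) g

Respects-[↦] : ∀ Y x xs c s g {y} → All (x ≢_) xs → y ∈ Y c →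
               Respects Y xs s g → Respects Y (x ∷ xs) (c ∷ s) (g [ x ↦ y ])
Respects-[↦] Y x xs c s g {y} x∉xs y∈Yc resp b a∈ with select-∷⁻ b x xs c s a∈
... | inj₁ (refl , refl) = subst (_∈ Y c) (sym ([↦]-same g x y)) y∈Yc
... | inj₂ a∈sel         = subst (_∈ Y b) (sym ([↦]-other g x y (select-∉ b xs s x∉xs a∈sel))) (resp b a∈sel)

∑split-cong : ∀ Y xs s {w w′} → Unique xs → (∀ g → Respects Y xs s g → w g ≡ w′ g) →
              ∑split Y xs s w ≡ ∑split Y xs s w′
∑split-cong Y []       []      []           w≡w′ = w≡w′ _ (λ _ ())
∑split-cong Y (x ∷ xs) (c ∷ s) (x∉xs ∷ u) w≡w′ = ∑-cong (Y c) λ {y} y∈Yc →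
  ∑split-cong Y xs s u (λ g resp → w≡w′ (g [ x ↦ y ]) (Respects-[↦] Y x xs c s g x∉xs y∈Yc resp))

∑maps-++ : ∀ Y xs w → ∑maps xs (Y false ++ Y true) w ≡ ∑ (bitVectors (length xs)) (λ s → ∑split Y xs s w)
∑maps-++ Y []       w = sym (+-identityʳ _)
∑maps-++ Y (x ∷ xs) w = begin
  ∑ (Y false ++ Y true) (λ y → ∑maps xs (Y false ++ Y true) (w′ y))
    ≡⟨ ∑-cong (Y false ++ Y true) (λ {y} _ → ∑maps-++ Y xs (w′ y)) ⟩
  ∑ (Y false ++ Y true) (λ y → ∑ ss (λ s → ∑split Y xs s (w′ y)))
    ≡⟨ ∑-++ (Y false) (Y true) _ ⟩
  ∑ (Y false) (λ y → ∑ ss (λ s → ∑split Y xs s (w′ y)))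
    + ∑ (Y true) (λ y → ∑ ss (λ s → ∑split Y xs s (w′ y)))
    ≡⟨ cong₂ _+_ (∑-swap (Y false) ss _) (∑-swap (Y true) ss _) ⟩
  ∑ ss (λ s → ∑split Y (x ∷ xs) (false ∷ s) w) + ∑ ss (λ s → ∑split Y (x ∷ xs) (true ∷ s) w)
    ≡⟨ cong₂ _+_ (∑-map (false ∷_) ss _) (∑-map (true ∷_) ss _) ⟨
  ∑ (map (false ∷_) ss) (λ s → ∑split Y (x ∷ xs) s w)
    + ∑ (map (true ∷_) ss) (λ s → ∑split Y (x ∷ xs) s w)
    ≡⟨ ∑-++ (map (false ∷_) ss) (map (true ∷_) ss) _ ⟨
  ∑ (bitVectors (length (x ∷ xs))) (λ s → ∑split Y (x ∷ xs) s w) ∎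
  where
  open ≡-Reasoning
  ss = bitVectors (length xs)
  w′ : ℕ → Weight
  w′ y g = w (g [ x ↦ y ])

∑split-* : ∀ Y xs s (w₁ w₂ : Weight) → Unique xs →
           DependsOn (select false xs s) w₁ → DependsOn (select true xs s) w₂ →
           ∑split Y xs s (λ g → w₁ g * w₂ g)
             ≡ ∑maps (select false xs s) (Y false) w₁ * ∑maps (select true xs s) (Y true) w₂
∑split-* Y []       []          w₁ w₂ u dep₁ dep₂ = refl
∑split-* Y (x ∷ xs) (false ∷ s) w₁ w₂ (x∉xs ∷ u) dep₁ dep₂ =
  trans (∑-cong (Y false) λ {y} _ →
          trans (∑split-cong Y xs s u (λ g _ → cong (w₁ (g [ x ↦ y ]) *_)
                   (dep₂ _ g (λ a∈ → [↦]-other g x y (select-∉ true xs s x∉xs a∈)))))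
                (∑split-* Y xs s _ w₂ u (DependsOn-[↦] x y _ w₁ dep₁) dep₂))
        (∑-*ʳ (Y false) _ _)
∑split-* Y (x ∷ xs) (true ∷ s)  w₁ w₂ (x∉xs ∷ u) dep₁ dep₂ =
  trans (∑-cong (Y true) λ {y} _ →
          trans (∑split-cong Y xs s u (λ g _ → cong (_* w₂ (g [ x ↦ y ]))
                   (dep₁ _ g (λ a∈ → [↦]-other g x y (select-∉ false xs s x∉xs a∈)))))
                (∑split-* Y xs s w₁ _ u dep₁ (DependsOn-[↦] x y _ w₂ dep₂)))
        (∑-*ˡ (Y true) (∑maps (select false xs s) (Y false) w₁) _)

module _ {σ : Schema} where

  ∈-adom⁺ : (I : Instance σ) {R : Fin (nsym σ)} {t : Vec ℕ (arity σ R)} {a : ℕ} →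
            t ∈ I R → a ∈ toList t → a ∈ adom I
  ∈-adom⁺ I {R} t∈ a∈ = Equivalence.to (deduplicate-∈⇔ _≟_)
    (∈-concatMap⁺ _ (Any.map (λ { refl → ∈-concatMap⁺ toList (Any.map (λ { refl → a∈ }) t∈) })
                             (∈-allFin R)))

  ∈-adom⁻ : (I : Instance σ) {a : ℕ} → a ∈ adom I →
            ∃ λ R → ∃ λ (t : Vec ℕ (arity σ R)) → t ∈ I R × a ∈ toList t
  ∈-adom⁻ I a∈ with find (∈-concatMap⁻ (λ R → concatMap toList (I R)) {xs = allFin (nsym σ)}
                                       (Equivalence.from (deduplicate-∈⇔ _≟_) a∈))
  ... | R , _ , a∈R with find (∈-concatMap⁻ toList {xs = I R} a∈R)
  ...   | t , t∈ , a∈t = R , t , t∈ , a∈t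

  adom-unique : (I : Instance σ) → Unique (adom I)
  adom-unique I = DecUnique.deduplicate-! _≟_ _

  IsHomMap-cong-local : (F E : Instance σ) {L : List ℕ} {g g′ : ℕ → ℕ} → adom F ⊆ L →
                        (∀ {a} → a ∈ L → g a ≡ g′ a) → IsHomMap F E g → IsHomMap F E g′
  IsHomMap-cong-local F E F⊆L g≡g′ hom R = All.tabulate λ {t} t∈ →
    subst (_∈ E R) (Vec-map-cong-local _ _ t (λ a∈ → g≡g′ (F⊆L (∈-adom⁺ F t∈ a∈))))
                   (All.lookup (hom R) t∈)

  homWeight : Instance σ → Instance σ → Weight
  homWeight F E = indicator ∘ isHomMap? F E

  homWeight-dependsOn : (F E : Instance σ) {L : List ℕ} → adom F ⊆ L → DependsOn L (homWeight F E)
  homWeight-dependsOn F E F⊆L g g′ g≡g′ = indicator-⇔ (isHomMap? F E g) (isHomMap? F E g′)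
    (mk⇔ (IsHomMap-cong-local F E F⊆L g≡g′) (IsHomMap-cong-local F E F⊆L (sym ∘ g≡g′)))

  homCount≡∑maps : (F E : Instance σ) → homCount F E ≡ ∑maps (adom F) (adom E) (homWeight F E)
  homCount≡∑maps F E = trans (length-filter (isHomMap? F E ∘ app (adom F)) (images (length (adom F)) (adom E)))
                              (∑-images (adom F) (adom E) (homWeight F E))

  homCount≢0⇔Hom : (F E : Instance σ) → homCount F E ≢ 0 ⇔ Hom F E
  homCount≢0⇔Hom F E = mk⇔ from-count to-count
    where
    from-count : homCount F E ≢ 0 → Hom F E
    from-count count≢0 with ∑maps≢0⇒ (adom F) (adom E) (homWeight F E) (count≢0 ∘ trans (homCount≡∑maps F E))
    ... | g , _ , weight≢0 = g , Equivalence.to (indicator≢0⇔ (isHomMap? F E g)) weight≢0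
    to-count : Hom F E → homCount F E ≢ 0
    to-count (h , hom) = ∑maps≢0⇐ (adom F) (adom E) (homWeight F E) (homWeight-dependsOn F E (λ a∈ → a∈))
      h h∈ (Equivalence.from (indicator≢0⇔ (isHomMap? F E h)) hom) ∘ trans (sym (homCount≡∑maps F E))
      where
      h∈ : MapsInto (adom F) (adom E) h
      h∈ a∈ with ∈-adom⁻ F a∈
      ... | R , t , t∈ , a∈t = ∈-adom⁺ E (All.lookup (hom R) t∈) (∈-toList-map⁺ h t a∈t)

-- hom κ factors through homCount via the semiring homomorphism ℕ → κ, so equality of
-- values under ⟦ κ ⟧ is a congruence for + and *.
⟦_⟧ : K → ℕ → ℕ
⟦ ℕK ⟧ n = n
⟦ 𝔹  ⟧ n = if n ≡ᵇ 0 then 0 else 1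

hom≡⟦homCount⟧ : ∀ κ {σ} (F D : Instance σ) → hom κ F D ≡ ⟦ κ ⟧ (homCount F D)
hom≡⟦homCount⟧ ℕK F D = refl
hom≡⟦homCount⟧ 𝔹  F D = refl

⟦⟧≡0⇔ : ∀ κ n → ⟦ κ ⟧ n ≡ 0 ⇔ n ≡ 0
⟦⟧≡0⇔ ℕK n       = mk⇔ (λ n≡0 → n≡0) (λ n≡0 → n≡0)
⟦⟧≡0⇔ 𝔹  zero    = mk⇔ (λ _ → refl) (λ _ → refl)
⟦⟧≡0⇔ 𝔹  (suc n) = mk⇔ (λ ()) (λ ())

⟦⟧-+-cong : ∀ κ {m m′ n n′} → ⟦ κ ⟧ m ≡ ⟦ κ ⟧ m′ → ⟦ κ ⟧ n ≡ ⟦ κ ⟧ n′ →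
            ⟦ κ ⟧ (m + n) ≡ ⟦ κ ⟧ (m′ + n′)
⟦⟧-+-cong ℕK                         m≡m′ n≡n′ = cong₂ _+_ m≡m′ n≡n′
⟦⟧-+-cong 𝔹 {zero}  {zero}          _    n≡n′ = n≡n′
⟦⟧-+-cong 𝔹 {suc _} {suc _}         _    _    = refl
⟦⟧-+-cong 𝔹 {zero}  {suc _}         ()
⟦⟧-+-cong 𝔹 {suc _} {zero}          ()

⟦⟧-*-congˡ : ∀ κ a {n n′} → ⟦ κ ⟧ n ≡ ⟦ κ ⟧ n′ → ⟦ κ ⟧ (a * n) ≡ ⟦ κ ⟧ (a * n′)
⟦⟧-*-congˡ ℕK a                         n≡n′ = cong (a *_) n≡n′
⟦⟧-*-congˡ 𝔹 zero                       _    = refl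
⟦⟧-*-congˡ 𝔹 (suc a) {zero}  {zero}    _    = refl
⟦⟧-*-congˡ 𝔹 (suc a) {suc _} {suc _}   _    = refl
⟦⟧-*-congˡ 𝔹 (suc a) {zero}  {suc _}   ()
⟦⟧-*-congˡ 𝔹 (suc a) {suc _} {zero}    ()

⟦⟧-∑-cong : ∀ κ (xs : List A) {f f′ : A → ℕ} → (∀ {x} → x ∈ xs → ⟦ κ ⟧ (f x) ≡ ⟦ κ ⟧ (f′ x)) →
            ⟦ κ ⟧ (∑ xs f) ≡ ⟦ κ ⟧ (∑ xs f′)
⟦⟧-∑-cong κ []       f≈f′ = refl
⟦⟧-∑-cong κ (x ∷ xs) f≈f′ = ⟦⟧-+-cong κ (f≈f′ (here refl)) (⟦⟧-∑-cong κ xs (f≈f′ ∘ there))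

hom≢0⇔Hom : ∀ κ {σ} (F E : Instance σ) → hom κ F E ≢ 0 ⇔ Hom F E
hom≢0⇔Hom κ F E = mk⇔
  (λ hom≢0 → Equivalence.to (homCount≢0⇔Hom F E) (hom≢0 ∘ Equivalence.from hom≡0⇔))
  (λ F→E → Equivalence.from (homCount≢0⇔Hom F E) F→E ∘ Equivalence.to hom≡0⇔)
  where
  hom≡0⇔ : hom κ F E ≡ 0 ⇔ homCount F E ≡ 0
  hom≡0⇔ = subst (λ n → n ≡ 0 ⇔ homCount F E ≡ 0) (sym (hom≡⟦homCount⟧ κ F E))
                 (⟦⟧≡0⇔ κ (homCount F E))

hom≡⇒Hom : ∀ κ {σ} {Q D D′ : Instance σ} → hom κ Q D ≡ hom κ Q D′ → Hom Q D → Hom Q D′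
hom≡⇒Hom κ {Q = Q} {D} {D′} same Q→D =
  Equivalence.to (hom≢0⇔Hom κ Q D′) (Equivalence.from (hom≢0⇔Hom κ Q D) Q→D ∘ trans same)

NonNullary : ∀ {n} → Vec ℕ n → Set
NonNullary {n} _ = 1 ≤ n

nonNullary? : ∀ {n} (t : Vec ℕ n) → Dec (NonNullary t)
nonNullary? {n} _ = 1 ≤? n

∈⇒NonNullary : ∀ {n a} {t : Vec ℕ n} → a ∈ toList t → NonNullary t
∈⇒NonNullary {t = _ ∷ _} _ = s≤s z≤n

nullary-unique : ∀ {n} (t u : Vec ℕ n) → ¬ NonNullary t → t ≡ u
nullary-unique []      []  _     = refl
nullary-unique (_ ∷ _) _   ¬1≤n = ⊥-elim (¬1≤n (s≤s z≤n))

module _ {σ : Schema} where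

  Hom-∘ : {E₁ E₂ E₃ : Instance σ} → Hom E₁ E₂ → Hom E₂ E₃ → Hom E₁ E₃
  Hom-∘ {E₃ = E₃} (h , hom) (h′ , hom′) = h′ ∘ h , λ R → All.tabulate λ {t} t∈ →
    subst (_∈ E₃ R) (sym (Vec.map-∘ h′ h t)) (All.lookup (hom′ R) (All.lookup (hom R) t∈))

  fact : Fin (nsym σ) → Instance σ
  fact R R′ with R Fin.≟ R′
  ... | yes refl = Vec.replicate _ 0 ∷ []
  ... | no _     = []

  fact-∈ : ∀ R → Vec.replicate _ 0 ∈ fact R R
  fact-∈ R with R Fin.≟ R
  ... | yes refl = here refl
  ... | no R≢R   = ⊥-elim (R≢R refl)

  Hom-fact⇔ : (E : Instance σ) (R : Fin (nsym σ)) {t : Vec ℕ (arity σ R)} →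
              ¬ NonNullary t → Hom (fact R) E ⇔ t ∈ E R
  Hom-fact⇔ E R {t} ¬nn = mk⇔
    (λ (h , hom) → subst (_∈ E R) (nullary-unique _ t ¬nn)
                          (All.lookup (hom R) (fact-∈ R)))
    (λ t∈ → (λ a → a) , λ R′ → All.tabulate (∈fact⇒∈E t∈))
    where
    ∈fact⇒∈E : t ∈ E R → ∀ {R′ u} → u ∈ fact R R′ → Vec.map (λ a → a) u ∈ E R′
    ∈fact⇒∈E t∈ {R′} u∈ with R Fin.≟ R′ | u∈
    ... | yes refl | here refl = subst (_∈ E R) (nullary-unique t _ ¬nn) t∈

-- Gluing D to a shifted copy of A

module Split {σ : Schema} (F : Instance σ) (s : Vec Bool (length (adom F))) where

  side : ℕ → Bool
  side = bitOf (adom F) s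

  OnSide : Bool → ∀ {n} → Vec ℕ n → Set
  OnSide b t = All (λ a → side a ≡ b) (toList t)

  onSide? : ∀ b {n} (t : Vec ℕ n) → Dec (OnSide b t)
  onSide? b t = All.all? (λ a → side a Bool.≟ b) (toList t)

  nullary-OnSide : ∀ b {n} (t : Vec ℕ n) → ¬ NonNullary t → OnSide b t
  nullary-OnSide b []      _      = All.[]
  nullary-OnSide b (_ ∷ _) ¬1≤n = ⊥-elim (¬1≤n (s≤s z≤n))

  OnSide-disjoint : ∀ {n} (t : Vec ℕ n) → NonNullary t → OnSide false t → OnSide true t → ⊥
  OnSide-disjoint (a ∷ _) _ (a≡false ∷ _) (a≡true ∷ _) with () ← trans (sym a≡false) a≡true

  onRight? : ∀ {n} (t : Vec ℕ n) → Dec (NonNullary t × OnSide true t)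
  onRight? t = nonNullary? t ×-dec onSide? true t

  -- A nullary fact is put on the left, since A↑∪ below keeps only the nullary facts of A.
  left right : Instance σ
  left  R = filter (onSide? false) (F R)
  right R = filter onRight? (F R)

  Separated : Set
  Separated = ∀ R → All (λ t → OnSide false t ⊎ OnSide true t) (F R)

  separated? : Dec Separated
  separated? = all? λ R → All.all? (λ t → onSide? false t ⊎-dec onSide? true t) (F R)

  on-side⇒select : ∀ {b R t a} → t ∈ F R → OnSide b t → a ∈ toList t → a ∈ select b (adom F) s
  on-side⇒select {b} t∈ onSide a∈t = select⁺ b (adom F) s (∈-adom⁺ F t∈ a∈t) (All.lookup onSide a∈t)

  adom-left⊆ : adom left ⊆ select false (adom F) s
  adom-left⊆ a∈ with ∈-adom⁻ left a∈
  ... | R , t , t∈ , a∈t = let t∈F , onLeft = ∈-filter⁻ (onSide? false) t∈ in on-side⇒select t∈F onLeft a∈t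

  adom-right⊆ : adom right ⊆ select true (adom F) s
  adom-right⊆ a∈ with ∈-adom⁻ right a∈
  ... | R , t , t∈ , a∈t = let t∈F , _ , onRight = ∈-filter⁻ onRight? t∈
                           in on-side⇒select t∈F onRight a∈t

  select-true⊆ : Separated → select true (adom F) s ⊆ adom right
  select-true⊆ sep a∈sel with ∈-adom⁻ F (select-⊆ true (adom F) s a∈sel)
  ... | R , t , t∈ , a∈t with All.lookup (sep R) t∈
  ...   | inj₁ onLeft  with () ← trans (sym (select⁻ true (adom F) s (adom-unique F) a∈sel))
                                         (All.lookup onLeft a∈t)
  ...   | inj₂ onRight = ∈-adom⁺ right (∈-filter⁺ onRight? t∈ (∈⇒NonNullary a∈t , onRight)) a∈t

  select-true↭adom-right : Separated → select true (adom F) s ↭ adom right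
  select-true↭adom-right sep = Unique-⊆-antisym (select-unique true (adom F) s (adom-unique F)) (adom-unique right)
                                                (select-true⊆ sep) adom-right⊆

  ∑maps-right : (D : Instance σ) → Separated →
                ∑maps (select true (adom F) s) (adom D) (homWeight right D) ≡ homCount right D
  ∑maps-right D sep = trans
    (∑maps-↭ˡ (adom D) (homWeight right D) (DependsOn⇒Extensional (homWeight-dependsOn right D (λ a∈ → a∈)))
              (select-unique true (adom F) s (adom-unique F)) (select-true↭adom-right sep))
    (sym (homCount≡∑maps right D))

module Shifted {σ : Schema} (m : ℕ) (A : Instance σ) where

  A↑ : Instance σ
  A↑ R = map (Vec.map (_+ m)) (A R)

  -- Nullary facts of D are dropped: they cannot be attributed to either side.
  A↑∪ : Instance σ → Instance σ
  A↑∪ D R = A↑ R ++ filter nonNullary? (D R)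

  Bounded : Instance σ → Set
  Bounded D = ∀ {a} → a ∈ adom D → a < m

  A↑-≥ : ∀ {a} → a ∈ adom A↑ → m ≤ a
  A↑-≥ a∈ with ∈-adom⁻ A↑ a∈
  ... | R , t , t∈ , a∈t with ∈-map⁻ (Vec.map (_+ m)) t∈
  ...   | u , _ , refl with ∈-toList-map⁻ (_+ m) u a∈t
  ...     | b , _ , refl = m≤n+m m b

  module _ (D : Instance σ) {R : Fin (nsym σ)} {t : Vec ℕ (arity σ R)} where

    ∈-A↑∪⁺ˡ : t ∈ A↑ R → t ∈ A↑∪ D R
    ∈-A↑∪⁺ˡ = ∈-++⁺ˡ

    ∈-A↑∪⁺ʳ : t ∈ D R → NonNullary t → t ∈ A↑∪ D R
    ∈-A↑∪⁺ʳ t∈ nn = ∈-++⁺ʳ (A↑ R) (∈-filter⁺ nonNullary? t∈ nn)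

    ∈-A↑∪⁻ : t ∈ A↑∪ D R → t ∈ A↑ R ⊎ (t ∈ D R × NonNullary t)
    ∈-A↑∪⁻ t∈ with ∈-++⁻ (A↑ R) t∈
    ... | inj₁ t∈A↑ = inj₁ t∈A↑
    ... | inj₂ t∈D  = inj₂ (∈-filter⁻ nonNullary? t∈D)

  adom-A↑∪-↭ : (D : Instance σ) → Bounded D → adom (A↑∪ D) ↭ adom A↑ ++ adom D
  adom-A↑∪-↭ D D<m = Unique-⊆-antisym (adom-unique (A↑∪ D))
    (Unique.++⁺ (adom-unique A↑) (adom-unique D) (λ (a∈A↑ , a∈D) → <⇒≱ (D<m a∈D) (A↑-≥ a∈A↑)))
    ⊆-++ ++-⊆
    where
    ⊆-++ : adom (A↑∪ D) ⊆ adom A↑ ++ adom D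
    ⊆-++ a∈ with ∈-adom⁻ (A↑∪ D) a∈
    ... | R , t , t∈ , a∈t with ∈-A↑∪⁻ D t∈
    ...   | inj₁ t∈A↑      = ∈-++⁺ˡ (∈-adom⁺ A↑ t∈A↑ a∈t)
    ...   | inj₂ (t∈D , _) = ∈-++⁺ʳ (adom A↑) (∈-adom⁺ D t∈D a∈t)
    ++-⊆ : adom A↑ ++ adom D ⊆ adom (A↑∪ D)
    ++-⊆ a∈ with ∈-++⁻ (adom A↑) a∈
    ... | inj₁ a∈A↑ with ∈-adom⁻ A↑ a∈A↑
    ...   | R , t , t∈ , a∈t = ∈-adom⁺ (A↑∪ D) (∈-A↑∪⁺ˡ D t∈) a∈t
    ++-⊆ a∈ | inj₂ a∈D with ∈-adom⁻ D a∈D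
    ...   | R , t , t∈ , a∈t = ∈-adom⁺ (A↑∪ D) (∈-A↑∪⁺ʳ D t∈ (∈⇒NonNullary a∈t)) a∈t

  codomain : Instance σ → Bool → List ℕ
  codomain D false = adom A↑
  codomain D true  = adom D

  module _ (F : Instance σ) (s : Vec Bool (length (adom F))) where

    open Split F s

    leftWeight : Weight
    leftWeight g = indicator separated? * homWeight left A↑ g

    leftCount : ℕ
    leftCount = ∑maps (select false (adom F) s) (adom A↑) leftWeight

    module _ (D : Instance σ) (D<m : Bounded D) (g : ℕ → ℕ) (resp : Respects (codomain D) (adom F) s g) where

      -- Constants of A↑ are ≥ m and those of D are < m, so the image of a fact reveals its side.
      private
        side-of-A↑ : ∀ {R t a} → t ∈ F R → Vec.map g t ∈ A↑ R → a ∈ toList t → side a ≡ false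
        side-of-A↑ {t = t} {a} t∈ gt∈ a∈t with side a in eq
        ... | false = refl
        ... | true  = ⊥-elim (<⇒≱ (D<m (resp true (select⁺ true (adom F) s (∈-adom⁺ F t∈ a∈t) eq)))
                                  (A↑-≥ (∈-adom⁺ A↑ gt∈ (∈-toList-map⁺ g t a∈t))))

        side-of-D : ∀ {R t a} → t ∈ F R → Vec.map g t ∈ D R → a ∈ toList t → side a ≡ true
        side-of-D {t = t} {a} t∈ gt∈ a∈t with side a in eq
        ... | true  = refl
        ... | false = ⊥-elim (<⇒≱ (D<m (∈-adom⁺ D gt∈ (∈-toList-map⁺ g t a∈t)))
                                  (A↑-≥ (resp false (select⁺ false (adom F) s (∈-adom⁺ F t∈ a∈t) eq))))

        image-side : ∀ {R t} → t ∈ F R → Vec.map g t ∈ A↑∪ D R →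
                     (OnSide false t × Vec.map g t ∈ A↑ R) ⊎ (OnSide true t × NonNullary t × Vec.map g t ∈ D R)
        image-side t∈ gt∈ with ∈-A↑∪⁻ D gt∈
        ... | inj₁ gt∈A↑       = inj₁ (All.tabulate (side-of-A↑ t∈ gt∈A↑) , gt∈A↑)
        ... | inj₂ (gt∈D , nn) = inj₂ (All.tabulate (side-of-D t∈ gt∈D) , nn , gt∈D)

        hom⇒separated : IsHomMap F (A↑∪ D) g → Separated
        hom⇒separated hom R = All.tabulate λ t∈ → Sum.map proj₁ proj₁ (image-side t∈ (All.lookup (hom R) t∈))

        hom⇒left : IsHomMap F (A↑∪ D) g → IsHomMap left A↑ g
        hom⇒left hom R = All.tabulate λ t∈ → let t∈F , onLeft = ∈-filter⁻ (onSide? false) t∈ in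
          case image-side t∈F (All.lookup (hom R) t∈F) of λ where
            (inj₁ (_ , gt∈A↑))        → gt∈A↑
            (inj₂ (onRight , nn , _)) → ⊥-elim (OnSide-disjoint _ nn onLeft onRight)

        hom⇒right : IsHomMap F (A↑∪ D) g → IsHomMap right D g
        hom⇒right hom R = All.tabulate λ t∈ → let t∈F , nn , onRight = ∈-filter⁻ onRight? t∈ in
          case image-side t∈F (All.lookup (hom R) t∈F) of λ where
            (inj₁ (onLeft , _))    → ⊥-elim (OnSide-disjoint _ nn onLeft onRight)
            (inj₂ (_ , _ , gt∈D)) → gt∈D

        parts⇒hom : Separated → IsHomMap left A↑ g → IsHomMap right D g → IsHomMap F (A↑∪ D) g
        parts⇒hom sep homˡ homʳ R = All.tabulate λ {t} t∈ → go t∈ (nonNullary? t) (All.lookup (sep R) t∈)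
          where
          left-image : ∀ {t} → t ∈ F R → OnSide false t → Vec.map g t ∈ A↑∪ D R
          left-image t∈ onLeft = ∈-A↑∪⁺ˡ D (All.lookup (homˡ R) (∈-filter⁺ (onSide? false) t∈ onLeft))
          go : ∀ {t} → t ∈ F R → Dec (NonNullary t) → OnSide false t ⊎ OnSide true t → Vec.map g t ∈ A↑∪ D R
          go {t} t∈ (no ¬nn) _          = left-image t∈ (nullary-OnSide false t ¬nn)
          go t∈ (yes nn) (inj₁ onLeft)  = left-image t∈ onLeft
          go t∈ (yes nn) (inj₂ onRight) =
            ∈-A↑∪⁺ʳ D (All.lookup (homʳ R) (∈-filter⁺ onRight? t∈ (nn , onRight))) nn

      homWeight-A↑∪ : homWeight F (A↑∪ D) g ≡ leftWeight g * homWeight right D g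
      homWeight-A↑∪ = begin
        homWeight F (A↑∪ D) g
          ≡⟨ indicator-⇔ (isHomMap? F (A↑∪ D) g) ((separated? ×-dec isHomMap? left A↑ g) ×-dec isHomMap? right D g)
               (mk⇔ (λ hom → (hom⇒separated hom , hom⇒left hom) , hom⇒right hom)
                    (λ ((sep , homˡ) , homʳ) → parts⇒hom sep homˡ homʳ)) ⟩
        indicator ((separated? ×-dec isHomMap? left A↑ g) ×-dec isHomMap? right D g)
          ≡⟨ indicator-× (separated? ×-dec isHomMap? left A↑ g) (isHomMap? right D g) ⟩
        indicator (separated? ×-dec isHomMap? left A↑ g) * homWeight right D g
          ≡⟨ cong (_* homWeight right D g) (indicator-× separated? (isHomMap? left A↑ g)) ⟩
        leftWeight g * homWeight right D g ∎
        where open ≡-Reasoning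

    leftCount≡0 : ¬ Separated → leftCount ≡ 0
    leftCount≡0 ¬sep = trans (∑maps-cong (select false (adom F) s) (adom A↑) (weight≡0 separated?))
                             (∑maps-zero (select false (adom F) s) (adom A↑))
      where
      weight≡0 : (sep? : Dec Separated) → ∀ g → indicator sep? * homWeight left A↑ g ≡ 0
      weight≡0 (yes sep) g = ⊥-elim (¬sep sep)
      weight≡0 (no _)    g = refl

    leftWeight-dependsOn : DependsOn (select false (adom F) s) leftWeight
    leftWeight-dependsOn g g′ g≡g′ =
      cong (indicator separated? *_) (homWeight-dependsOn left A↑ adom-left⊆ g g′ g≡g′)

    splitCount : (D : Instance σ) → Bounded D →
                 ∑split (codomain D) (adom F) s (homWeight F (A↑∪ D)) ≡ leftCount * homCount right D
    splitCount D D<m = begin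
      ∑split (codomain D) (adom F) s (homWeight F (A↑∪ D))
        ≡⟨ ∑split-cong (codomain D) (adom F) s (adom-unique F) (homWeight-A↑∪ D D<m) ⟩
      ∑split (codomain D) (adom F) s (λ g → leftWeight g * homWeight right D g)
        ≡⟨ ∑split-* (codomain D) (adom F) s leftWeight (homWeight right D) (adom-unique F)
                    leftWeight-dependsOn (homWeight-dependsOn right D adom-right⊆) ⟩
      leftCount * ∑maps (select true (adom F) s) (adom D) (homWeight right D)
        ≡⟨ *-congˡ-when-≢0 leftCount (λ count≢0 →
             ∑maps-right D (decidable-stable separated? (count≢0 ∘ leftCount≡0))) ⟩
      leftCount * homCount right D ∎
      where open ≡-Reasoning

  homCount-A↑∪ : (F D : Instance σ) → Bounded D →
                 homCount F (A↑∪ D)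
                   ≡ ∑ (bitVectors (length (adom F))) (λ s → leftCount F s * homCount (Split.right F s) D)
  homCount-A↑∪ F D D<m = begin
    homCount F (A↑∪ D)
      ≡⟨ homCount≡∑maps F (A↑∪ D) ⟩
    ∑maps (adom F) (adom (A↑∪ D)) (homWeight F (A↑∪ D))
      ≡⟨ ∑maps-↭ʳ (adom F) (homWeight F (A↑∪ D)) (adom-A↑∪-↭ D D<m) ⟩
    ∑maps (adom F) (adom A↑ ++ adom D) (homWeight F (A↑∪ D))
      ≡⟨ ∑maps-++ (codomain D) (adom F) (homWeight F (A↑∪ D)) ⟩
    ∑ (bitVectors (length (adom F))) (λ s → ∑split (codomain D) (adom F) s (homWeight F (A↑∪ D)))
      ≡⟨ ∑-cong (bitVectors (length (adom F))) (λ {s} _ → splitCount F s D D<m) ⟩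
    ∑ (bitVectors (length (adom F))) (λ s → leftCount F s * homCount (Split.right F s) D) ∎
    where open ≡-Reasoning

  hom-A↑∪-cong : ∀ κ (F D D′ : Instance σ) → Bounded D → Bounded D′ →
                 (∀ {s} → s ∈ bitVectors (length (adom F)) →
                          hom κ (Split.right F s) D ≡ hom κ (Split.right F s) D′) →
                 hom κ F (A↑∪ D) ≡ hom κ F (A↑∪ D′)
  hom-A↑∪-cong κ F D D′ D<m D′<m same-right = begin
    hom κ F (A↑∪ D)
      ≡⟨ hom≡⟦homCount⟧ κ F (A↑∪ D) ⟩
    ⟦ κ ⟧ (homCount F (A↑∪ D))
      ≡⟨ cong ⟦ κ ⟧ (homCount-A↑∪ F D D<m) ⟩
    ⟦ κ ⟧ (∑ ss (λ s → leftCount F s * homCount (Split.right F s) D))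
      ≡⟨ ⟦⟧-∑-cong κ ss (λ {s} s∈ → ⟦⟧-*-congˡ κ (leftCount F s) (begin
           ⟦ κ ⟧ (homCount (Split.right F s) D)  ≡⟨ hom≡⟦homCount⟧ κ (Split.right F s) D ⟨
           hom κ (Split.right F s) D             ≡⟨ same-right s∈ ⟩
           hom κ (Split.right F s) D′            ≡⟨ hom≡⟦homCount⟧ κ (Split.right F s) D′ ⟩
           ⟦ κ ⟧ (homCount (Split.right F s) D′) ∎)) ⟩
    ⟦ κ ⟧ (∑ ss (λ s → leftCount F s * homCount (Split.right F s) D′))
      ≡⟨ cong ⟦ κ ⟧ (homCount-A↑∪ F D′ D′<m) ⟨
    ⟦ κ ⟧ (homCount F (A↑∪ D′))
      ≡⟨ hom≡⟦homCount⟧ κ F (A↑∪ D′) ⟨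
    hom κ F (A↑∪ D′) ∎
    where
    open ≡-Reasoning
    ss = bitVectors (length (adom F))

  A→A↑∪ : (D : Instance σ) → Hom A (A↑∪ D)
  A→A↑∪ D = (_+ m) , λ R → All.tabulate λ t∈ → ∈-A↑∪⁺ˡ D (∈-map⁺ (Vec.map (_+ m)) t∈)

  unshift : (ℕ → ℕ) → ℕ → ℕ
  unshift h a with m ≤? a
  ... | yes _ = a ∸ m
  ... | no _  = h a

  unshift-↑ : ∀ h b → unshift h (b + m) ≡ b
  unshift-↑ h b with m ≤? b + m
  ... | yes _   = m+n∸n≡m b m
  ... | no m≰b+m = ⊥-elim (m≰b+m (m≤n+m m b))

  unshift-< : ∀ h {a} → a < m → unshift h a ≡ h a
  unshift-< h {a} a<m with m ≤? a
  ... | yes m≤a = ⊥-elim (<⇒≱ a<m m≤a)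
  ... | no _    = refl

  A↑∪→A : (D : Instance σ) → Bounded D → Hom D A → Hom (A↑∪ D) A
  A↑∪→A D D<m (h , hom) = unshift h , λ R → All.tabulate (image∈A ∘ ∈-A↑∪⁻ D)
    where
    image∈A : ∀ {R t} → t ∈ A↑ R ⊎ (t ∈ D R × NonNullary t) → Vec.map (unshift h) t ∈ A R
    image∈A {R} (inj₁ t∈A↑) with ∈-map⁻ (Vec.map (_+ m)) t∈A↑
    ... | u , u∈A , refl = subst (_∈ A R) (sym (begin
          Vec.map (unshift h) (Vec.map (_+ m) u) ≡⟨ Vec.map-∘ (unshift h) (_+ m) u ⟨
          Vec.map (unshift h ∘ (_+ m)) u         ≡⟨ Vec.map-cong (unshift-↑ h) u ⟩
          Vec.map (λ b → b) u                    ≡⟨ Vec.map-id u ⟩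
          u                                      ∎)) u∈A
      where open ≡-Reasoning
    image∈A {R} {t} (inj₂ (t∈D , _)) = subst (_∈ A R)
      (Vec-map-cong-local h (unshift h) t (λ a∈t → sym (unshift-< h (D<m (∈-adom⁺ D t∈D a∈t)))))
      (All.lookup (hom R) t∈D)

  A↑∪→A⇒D→A : (D : Instance σ) → Hom (A↑∪ D) A →
              (∀ R {t} → t ∈ D R → ¬ NonNullary t → t ∈ A R) → Hom D A
  A↑∪→A⇒D→A D (h , hom) nullary∈A = h , λ R → All.tabulate λ {t} t∈ → image∈A t∈ (nonNullary? t)
    where
    image∈A : ∀ {R t} → t ∈ D R → Dec (NonNullary t) → Vec.map h t ∈ A R
    image∈A {R} t∈ (yes nn)          = All.lookup (hom R) (∈-A↑∪⁺ʳ D t∈ nn)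
    image∈A {R} {t} t∈ (no ¬nn) = subst (_∈ A R) (nullary-unique t _ ¬nn) (nullary∈A R t∈ ¬nn)

module _ {σ : Schema} (A : Instance σ) (κ : K) where

  answers : ∀ {k} → Vec (Instance σ) k → Instance σ → Vec ℕ k
  answers Fs D = Vec.map (λ F → hom κ F D) Fs

  CSP⇒HomEq : LeftQueryAlgorithm κ (CSP A) → LeftQueryAlgorithm κ (HomEq A)
  CSP⇒HomEq (k , _ , Fs , X , correct) = suc k , s≤s z≤n , A ∷ Fs , X′ , correct′
    where
    X′ : Vec ℕ (suc k) → Set
    X′ (n ∷ v) = n ≢ 0 × X v
    correct′ : ∀ D → HomEq A D ⇔ X′ (answers (A ∷ Fs) D)
    correct′ D = mk⇔
      (λ (A→D , D→A) → Equivalence.from (hom≢0⇔Hom κ A D) A→D , Equivalence.to (correct D) D→A)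
      (λ (hom≢0 , x) → Equivalence.to (hom≢0⇔Hom κ A D) hom≢0 , Equivalence.from (correct D) x)

  queries : ∀ {k} → Vec (Instance σ) k → List (Instance σ)
  queries Fs = concatMap (λ F → map (Split.right F) (bitVectors (length (adom F)))) (toList Fs)
            ++ map fact (allFin (nsym σ))

  CSP-determined-by-queries : ∀ {k} (Fs : Vec (Instance σ) k) (X : Vec ℕ k → Set) →
                              (∀ D → HomEq A D ⇔ X (answers Fs D)) → (D D′ : Instance σ) →
                              (∀ {Q} → Q ∈ queries Fs → hom κ Q D ≡ hom κ Q D′) → Hom D′ A → Hom D A
  CSP-determined-by-queries Fs X correct D D′ same D′→A = A↑∪→A⇒D→A D A↑∪D→A nullary∈A
    where
    m : ℕ
    m = suc (max 0 (adom D ++ adom D′))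
    open Shifted m A
    D<m : Bounded D
    D<m a∈ = s≤s (All.lookup (xs≤max 0 (adom D ++ adom D′)) (∈-++⁺ˡ a∈))
    D′<m : Bounded D′
    D′<m a∈ = s≤s (All.lookup (xs≤max 0 (adom D ++ adom D′)) (∈-++⁺ʳ (adom D) a∈))
    same-answers : answers Fs (A↑∪ D′) ≡ answers Fs (A↑∪ D)
    same-answers = Vec-map-cong-local _ _ Fs λ {F} F∈ → hom-A↑∪-cong κ F D′ D D′<m D<m λ s∈ →
      sym (same (∈-++⁺ˡ (∈-concatMap⁺ _ (Any.map (λ { refl → ∈-map⁺ (Split.right F) s∈ }) F∈))))
    A↑∪D→A : Hom (A↑∪ D) A
    A↑∪D→A = proj₂ (Equivalence.from (correct (A↑∪ D)) (subst X same-answers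
               (Equivalence.to (correct (A↑∪ D′)) (A→A↑∪ D′ , A↑∪→A D′ D′<m D′→A))))
    nullary∈A : ∀ R {t} → t ∈ D R → ¬ NonNullary t → t ∈ A R
    nullary∈A R t∈ ¬nn = Equivalence.to (Hom-fact⇔ A R ¬nn) (Hom-∘ fact→D′ D′→A)
      where
      fact→D′ : Hom (fact R) D′
      fact→D′ = hom≡⇒Hom κ (same (∈-++⁺ʳ _ (∈-map⁺ fact (∈-allFin R))))
                          (Equivalence.from (Hom-fact⇔ D R ¬nn) t∈)

  HomEq⇒CSP : LeftQueryAlgorithm κ (HomEq A) → LeftQueryAlgorithm κ (CSP A)
  HomEq⇒CSP (k , _ , Fs , X , correct) = suc (length (queries Fs)) , s≤s z≤n , Qs , X′ , correct′
    where
    -- A is prepended only to make the number of queries positive.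
    Qs : Vec (Instance σ) (suc (length (queries Fs)))
    Qs = A ∷ Vec.fromList (queries Fs)
    -- X′ need not be decidable: it collects the answers of the members of CSP(A), and
    -- CSP-determined-by-queries shows that no other instance gives the same answers.
    X′ : Vec ℕ (suc (length (queries Fs))) → Set
    X′ v = ∃ λ D′ → answers Qs D′ ≡ v × Hom D′ A
    correct′ : ∀ D → CSP A D ⇔ X′ (answers Qs D)
    correct′ D = mk⇔ (λ D→A → D , refl , D→A) λ (D′ , same , D′→A) →
      CSP-determined-by-queries Fs X correct D D′
        (λ Q∈ → sym (Vec-map-≡⇒∈-≡ _ _ Qs same
                       (there (subst (_ ∈_) (sym (Vec.toList∘fromList (queries Fs))) Q∈))))
        D′→A

proposition12 : {σ : Schema} (A : Instance σ) (κ : K) →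
    LeftQueryAlgorithm κ (HomEq A) ⇔ LeftQueryAlgorithm κ (CSP A)
proposition12 A κ = mk⇔ (HomEq⇒CSP A κ) (CSP⇒HomEq A κ)
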